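{- Let $t, r, s$ be integers with $1 \leq t \leq r \leq s$, let $\mathcal{H}$ be a hereditary family with $\mu(\mathcal{H}) \geq r+s-t+1$, let $I \in \mathcal{H}$ with $t \leq |I| \leq r$, and let $\mathcal{A} = \mathcal{H}^{(r)}(I)$ and $\mathcal{B} = \{B \in \mathcal{H}^{(s)} \colon |B \cap I| \geq t\}$. Then $|\mathcal{A}| + |\mathcal{B}| \leq |\mathcal{H}^{(s)}|$, and equality holds only if $t = 1$ and $\mu(\mathcal{H}) = r+s$.
   Context: All sets and families (sets of sets) are finite. A family $\mathcal{H}$ is hereditary if for every $A \in \mathcal{H}$, every subset of $A$ is in $\mathcal{H}$. For a family $\mathcal{F}$, $\mathcal{F}^{(r)}$ denotes the family of $r$-element sets in $\mathcal{F}$. A set $B \in \mathcal{F}$ is a base of $\mathcal{F}$ if $B$ is not a proper subset of any $A \in \mathcal{F}$; $\mu(\mathcal{F})$ is the size of a smallest base of $\mathcal{F}$. For a family $\mathcal{F}$ and a set $T$, $\mathcal{F}(T) = \{A \in \mathcal{F} \colon T \subseteq A\}$. -}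

module Defs where

open import Data.Nat using (ℕ; zero; suc; _≤_; _≤?_)
open import Data.Nat.Properties using (_≟_)
open import Data.Bool using (Bool; true; false; _∧_)
open import Data.List using (List; []; _∷_; _++_; map; length; filterᵇ)
open import Data.Vec using ([]; _∷_)
open import Data.Fin.Subset using (Subset; inside; outside; _⊆_; _⊂_; _∩_; ∣_∣)
open import Data.Fin.Subset.Properties using (_⊆?_)
open import Data.Product using (Σ; _×_)
open import Relation.Nullary using (¬_)
open import Relation.Nullary.Decidable using (⌊_⌋)
open import Relation.Binary.PropositionalEquality using (_≡_)

Family : ℕ → Set
Family n = Subset n → Bool

_∈F_ : {n : ℕ} → Subset n → Family n → Set
A ∈F H = H A ≡ true

allSubsets : (n : ℕ) → List (Subset n)
allSubsets zero = [] ∷ []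
allSubsets (suc n) = map (inside ∷_) (allSubsets n) ++ map (outside ∷_) (allSubsets n)

card : {n : ℕ} → Family n → ℕ
card {n} F = length (filterᵇ F (allSubsets n))

Hereditary : {n : ℕ} → Family n → Set
Hereditary {n} H = (A B : Subset n) → A ∈F H → B ⊆ A → B ∈F H

layer : {n : ℕ} → Family n → ℕ → Family n
layer F r A = F A ∧ ⌊ ∣ A ∣ ≟ r ⌋

containing : {n : ℕ} → Family n → Subset n → Family n
containing F T A = F A ∧ ⌊ T ⊆? A ⌋

IsBase : {n : ℕ} → Family n → Subset n → Set
IsBase {n} F B = B ∈F F × ((A : Subset n) → A ∈F F → ¬ (B ⊂ A))

IsMu : {n : ℕ} → Family n → ℕ → Set
IsMu {n} F m =
  Σ (Subset n) (λ B → IsBase F B × ∣ B ∣ ≡ m)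
  × ((B : Subset n) → IsBase F B → m ≤ ∣ B ∣)

meetFamily : {n : ℕ} → Family n → ℕ → Subset n → ℕ → Family n
meetFamily H s I t B = layer H s B ∧ ⌊ t ≤? ∣ B ∩ I ∣ ⌋

-- Let x k = |H^(k)(I)| and M = μ(H) ≥ r + s − t + 1. Each X ∈ H^(k)(I) lies in a base of
-- size ≥ M, so it has at least M − k one-element extensions inside H, while each member of
-- H^(k+1)(I) arises from at most k + 1 − |I| of them: (M − k) x k ≤ (k + 1 − |I|) x (k + 1),
-- i.e. x (|I| + a) / C(M − |I|, a) is nondecreasing. With a = r − |I| and b = s − t + 1
-- (a < b and a + b ≤ M − |I|) symmetry of binomials gives x r ≤ x (|I| + b). Fixing J ⊆ I with
-- |J| = t − 1, the map X ↦ X ∖ (I ∖ J) injects H^(|I|+b)(I) into the members B of H^(s) with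
-- |B ∩ I| < t. In the equality case this injection is onto, which fails for t ≥ 2, and
-- x r = x (|I| + b), which fails for μ(H) > r + s because then (b + 1) x r ≤ (a + 1) x (|I| + b).

module Submission where

open import Defs
open import Data.Nat using (ℕ; zero; suc; _+_; _*_; _∸_; _≤_; _<_; z≤n; s≤s; _!; >-nonZero)
open import Data.Nat.Properties
open import Data.Nat.ListAction using (sum)
open import Data.Nat.ListAction.Properties using (sum-++)
open import Data.Nat.Tactic.RingSolver using (solve-∀)
open import Algebra.Properties.CommutativeSemigroup +-commutativeSemigroup using () renaming (interchange to +-interchange)
open import Algebra.Properties.CommutativeSemigroup *-commutativeSemigroup using () renaming (x∙yz≈y∙xz to m*[n*o]≡n*[m*o])
open import Data.Bool using (Bool; true; false; _∧_; not)
open import Data.Bool.Properties using () renaming (_≟_ to _≟ᵇ_)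
open import Data.List using (List; []; _∷_; _++_; map; length; filterᵇ)
open import Data.List.Properties using (map-++; map-∘)
open import Data.Vec using ([]; _∷_; here; there; lookup; _[_]≔_)
open import Data.Vec.Properties using ([]=⇒lookup; lookup⇒[]=; lookup∘update; lookup∘update′; []≔-idempotent; []≔-lookup)
open import Data.Fin as Fin using (Fin; zero; suc)
open import Data.Fin.Subset using (Subset; inside; outside; ∣_∣; _∈_; _∉_; _⊆_; _∩_; _─_; ∁; ⊥; ⁅_⁆; Nonempty)
open import Data.Fin.Subset.Properties
open import Data.Product using (∃; _×_; _,_; proj₁; proj₂)
open import Data.Sum using (inj₁; inj₂)
open import Function using (_∘_)
open import Relation.Nullary using (¬_; Dec; yes; no; contradiction)
open import Relation.Nullary.Decidable using (⌊_⌋; _×-dec_; map′; ¬?)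
open import Relation.Unary as U using ()
open import Relation.Binary.PropositionalEquality

private
  variable
    m n : ℕ

-- Counting with sums over subsets

⟦_⟧ : Bool → ℕ
⟦ true ⟧ = 1
⟦ false ⟧ = 0

⟦⟧-mono : ∀ {a b} → (a ≡ true → b ≡ true) → ⟦ a ⟧ ≤ ⟦ b ⟧
⟦⟧-mono {false} _ = z≤n
⟦⟧-mono {true} a⇒b rewrite a⇒b refl = ≤-refl

⟦⟧-false : ∀ {a} → a ≢ true → ⟦ a ⟧ ≡ 0
⟦⟧-false {false} _ = refl
⟦⟧-false {true} a≢true = contradiction refl a≢true

⌊⌋-true⇒ : {A : Set} (a? : Dec A) → ⌊ a? ⌋ ≡ true → A
⌊⌋-true⇒ (yes a) _ = a

⌊⌋-true⇐ : {A : Set} (a? : Dec A) → A → ⌊ a? ⌋ ≡ true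
⌊⌋-true⇐ (yes _) _ = refl
⌊⌋-true⇐ (no ¬a) a = contradiction a ¬a

⌊⌋-false⇐ : {A : Set} (a? : Dec A) → ¬ A → ⌊ a? ⌋ ≡ false
⌊⌋-false⇐ (yes a) ¬a = contradiction a ¬a
⌊⌋-false⇐ (no _) _ = refl

⟦⟧-*-≤ : ∀ {a b c d e} → (a ≡ true → b ≡ true → c ≡ true → d ≡ true × e ≡ false) →
         ⟦ a ⟧ * (⟦ b ⟧ * ⟦ c ⟧) ≤ ⟦ d ⟧ * (⟦ not e ⟧ * ⟦ a ⟧)
⟦⟧-*-≤ {false} _ = z≤n
⟦⟧-*-≤ {true} {false} _ = z≤n
⟦⟧-*-≤ {true} {true} {false} _ = z≤n
⟦⟧-*-≤ {true} {true} {true} imp with refl , refl ← imp refl refl refl = ≤-refl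

∧-true⁻ : ∀ {a b} → a ∧ b ≡ true → a ≡ true × b ≡ true
∧-true⁻ {true} e = refl , e

sumSubsets : (Subset n → ℕ) → ℕ
sumSubsets {zero} f = f []
sumSubsets {suc n} f = sumSubsets (f ∘ (inside ∷_)) + sumSubsets (f ∘ (outside ∷_))

sumFin : (Fin n → ℕ) → ℕ
sumFin {zero} f = 0
sumFin {suc n} f = f zero + sumFin (f ∘ suc)

sumSubsets-cong : {f g : Subset n → ℕ} → (∀ X → f X ≡ g X) → sumSubsets f ≡ sumSubsets g
sumSubsets-cong {zero} f≗g = f≗g []
sumSubsets-cong {suc n} f≗g =
  cong₂ _+_ (sumSubsets-cong (f≗g ∘ (inside ∷_))) (sumSubsets-cong (f≗g ∘ (outside ∷_)))

sumSubsets-mono-≤ : {f g : Subset n → ℕ} → (∀ X → f X ≤ g X) → sumSubsets f ≤ sumSubsets g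
sumSubsets-mono-≤ {zero} f≤g = f≤g []
sumSubsets-mono-≤ {suc n} f≤g =
  +-mono-≤ (sumSubsets-mono-≤ (f≤g ∘ (inside ∷_))) (sumSubsets-mono-≤ (f≤g ∘ (outside ∷_)))

sumSubsets-mono-< : {f g : Subset n → ℕ} → (∀ X → f X ≤ g X) →
                    (Y : Subset n) → f Y < g Y → sumSubsets f < sumSubsets g
sumSubsets-mono-< {zero} f≤g [] fY<gY = fY<gY
sumSubsets-mono-< {suc n} f≤g (inside ∷ Y) fY<gY =
  +-mono-<-≤ (sumSubsets-mono-< (f≤g ∘ (inside ∷_)) Y fY<gY) (sumSubsets-mono-≤ (f≤g ∘ (outside ∷_)))
sumSubsets-mono-< {suc n} f≤g (outside ∷ Y) fY<gY =
  +-mono-≤-< (sumSubsets-mono-≤ (f≤g ∘ (inside ∷_))) (sumSubsets-mono-< (f≤g ∘ (outside ∷_)) Y fY<gY)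

sumSubsets-zero : sumSubsets {n} (λ _ → 0) ≡ 0
sumSubsets-zero {zero} = refl
sumSubsets-zero {suc n} = cong₂ _+_ (sumSubsets-zero {n}) (sumSubsets-zero {n})

sumSubsets-pos : (f : Subset n → ℕ) (Y : Subset n) → 0 < f Y → 0 < sumSubsets f
sumSubsets-pos {n} f Y 0<fY =
  subst (_< sumSubsets f) (sumSubsets-zero {n}) (sumSubsets-mono-< (λ _ → z≤n) Y 0<fY)

sumSubsets-+ : (f g : Subset n → ℕ) → sumSubsets (λ X → f X + g X) ≡ sumSubsets f + sumSubsets g
sumSubsets-+ {zero} f g = refl
sumSubsets-+ {suc n} f g = begin
  sumSubsets (λ X → f (inside ∷ X) + g (inside ∷ X)) + sumSubsets (λ X → f (outside ∷ X) + g (outside ∷ X))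
    ≡⟨ cong₂ _+_ (sumSubsets-+ (f ∘ (inside ∷_)) (g ∘ (inside ∷_)))
                 (sumSubsets-+ (f ∘ (outside ∷_)) (g ∘ (outside ∷_))) ⟩
  (sumSubsets (f ∘ (inside ∷_)) + sumSubsets (g ∘ (inside ∷_))) + (sumSubsets (f ∘ (outside ∷_)) + sumSubsets (g ∘ (outside ∷_)))
    ≡⟨ +-interchange (sumSubsets (f ∘ (inside ∷_))) _ (sumSubsets (f ∘ (outside ∷_))) _ ⟩
  sumSubsets f + sumSubsets g ∎
  where open ≡-Reasoning

sumSubsets-* : (c : ℕ) (f : Subset n → ℕ) → sumSubsets (λ X → c * f X) ≡ c * sumSubsets f
sumSubsets-* {zero} c f = refl
sumSubsets-* {suc n} c f =
  trans (cong₂ _+_ (sumSubsets-* c (f ∘ (inside ∷_))) (sumSubsets-* c (f ∘ (outside ∷_))))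
        (sym (*-distribˡ-+ c _ _))

sumFin-mono-≤ : {f g : Fin n → ℕ} → (∀ j → f j ≤ g j) → sumFin f ≤ sumFin g
sumFin-mono-≤ {zero} f≤g = z≤n
sumFin-mono-≤ {suc n} f≤g = +-mono-≤ (f≤g zero) (sumFin-mono-≤ (f≤g ∘ suc))

sumFin-cong : {f g : Fin n → ℕ} → (∀ j → f j ≡ g j) → sumFin f ≡ sumFin g
sumFin-cong {zero} f≗g = refl
sumFin-cong {suc n} f≗g = cong₂ _+_ (f≗g zero) (sumFin-cong (f≗g ∘ suc))

sumFin-* : (c : ℕ) (f : Fin n → ℕ) → sumFin (λ j → c * f j) ≡ c * sumFin f
sumFin-* {zero} c f = sym (*-zeroʳ c)
sumFin-* {suc n} c f = trans (cong (c * f zero +_) (sumFin-* c (f ∘ suc))) (sym (*-distribˡ-+ c _ _))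

sumSubsets-sumFin-comm : (f : Subset n → Fin m → ℕ) →
  sumSubsets (λ X → sumFin (f X)) ≡ sumFin (λ j → sumSubsets (λ X → f X j))
sumSubsets-sumFin-comm {n} {zero} f = sumSubsets-zero {n}
sumSubsets-sumFin-comm {n} {suc m} f =
  trans (sumSubsets-+ (λ X → f X zero) (λ X → sumFin (f X ∘ suc)))
        (cong (sumSubsets (λ X → f X zero) +_) (sumSubsets-sumFin-comm (λ X → f X ∘ suc)))

length-filterᵇ : {A : Set} (P : A → Bool) (xs : List A) → length (filterᵇ P xs) ≡ sum (map (⟦_⟧ ∘ P) xs)
length-filterᵇ P [] = refl
length-filterᵇ P (x ∷ xs) with P x
... | true = cong suc (length-filterᵇ P xs)
... | false = length-filterᵇ P xs

sum-allSubsets : (f : Subset n → ℕ) → sum (map f (allSubsets n)) ≡ sumSubsets f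
sum-allSubsets {zero} f = +-identityʳ (f [])
sum-allSubsets {suc n} f = begin
  sum (map f (map (inside ∷_) Xs ++ map (outside ∷_) Xs))
    ≡⟨ cong sum (map-++ f (map (inside ∷_) Xs) _) ⟩
  sum (map f (map (inside ∷_) Xs) ++ map f (map (outside ∷_) Xs))
    ≡⟨ sum-++ (map f (map (inside ∷_) Xs)) _ ⟩
  sum (map f (map (inside ∷_) Xs)) + sum (map f (map (outside ∷_) Xs))
    ≡⟨ cong₂ _+_ (cong sum (sym (map-∘ Xs))) (cong sum (sym (map-∘ Xs))) ⟩
  sum (map (f ∘ (inside ∷_)) Xs) + sum (map (f ∘ (outside ∷_)) Xs)
    ≡⟨ cong₂ _+_ (sum-allSubsets (f ∘ (inside ∷_))) (sum-allSubsets (f ∘ (outside ∷_))) ⟩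
  sumSubsets f ∎
  where
  open ≡-Reasoning
  Xs = allSubsets n

card≡sumSubsets : (F : Family n) → card F ≡ sumSubsets (⟦_⟧ ∘ F)
card≡sumSubsets {n} F = trans (length-filterᵇ F (allSubsets n)) (sum-allSubsets (⟦_⟧ ∘ F))

card-pos : (F : Family n) {X : Subset n} → X ∈F F → 0 < card F
card-pos F {X} X∈F = subst (0 <_) (sym (card≡sumSubsets F))
  (sumSubsets-pos (⟦_⟧ ∘ F) X (≤-reflexive (cong ⟦_⟧ (sym X∈F))))

∈⇒lookup : {j : Fin n} {p : Subset n} → j ∈ p → lookup p j ≡ inside
∈⇒lookup = []=⇒lookup

lookup⇒∈ : {j : Fin n} {p : Subset n} → lookup p j ≡ inside → j ∈ p
lookup⇒∈ {j = j} {p} = lookup⇒[]= j p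

∉⇒lookup : {j : Fin n} {p : Subset n} → j ∉ p → lookup p j ≡ outside
∉⇒lookup {j = j} {p} j∉p with lookup p j in p[j]
... | inside = contradiction (lookup⇒∈ p[j]) j∉p
... | outside = refl

j∉p[j]≔outside : (p : Subset n) (j : Fin n) → j ∉ p [ j ]≔ outside
j∉p[j]≔outside p j j∈ with () ← trans (sym (lookup∘update j p outside)) (∈⇒lookup j∈)

x∈p─q⇒x∉q : {x : Fin n} (p q : Subset n) → x ∈ p ─ q → x ∉ q
x∈p─q⇒x∉q (_ ∷ p) (inside ∷ q) (there x∈p─q) (there x∈q) = x∈p─q⇒x∉q p q x∈p─q x∈q
x∈p─q⇒x∉q (_ ∷ p) (outside ∷ q) (there x∈p─q) (there x∈q) = x∈p─q⇒x∉q p q x∈p─q x∈q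

∣p─q∣+∣q∣≡∣p∣ : (p q : Subset n) → q ⊆ p → ∣ p ─ q ∣ + ∣ q ∣ ≡ ∣ p ∣
∣p─q∣+∣q∣≡∣p∣ [] [] _ = refl
∣p─q∣+∣q∣≡∣p∣ (inside ∷ p) (inside ∷ q) q⊆p =
  trans (+-suc _ _) (cong suc (∣p─q∣+∣q∣≡∣p∣ p q (drop-∷-⊆ q⊆p)))
∣p─q∣+∣q∣≡∣p∣ (inside ∷ p) (outside ∷ q) q⊆p = cong suc (∣p─q∣+∣q∣≡∣p∣ p q (drop-∷-⊆ q⊆p))
∣p─q∣+∣q∣≡∣p∣ (outside ∷ p) (outside ∷ q) q⊆p = ∣p─q∣+∣q∣≡∣p∣ p q (drop-∷-⊆ q⊆p)
∣p─q∣+∣q∣≡∣p∣ (outside ∷ p) (inside ∷ q) q⊆p with () ← q⊆p here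

∣p─q∣≡sumFin : (p q : Subset n) → ∣ p ─ q ∣ ≡ sumFin (λ j → ⟦ not (lookup q j) ⟧ * ⟦ lookup p j ⟧)
∣p─q∣≡sumFin [] [] = refl
∣p─q∣≡sumFin (_ ∷ p) (inside ∷ q) = ∣p─q∣≡sumFin p q
∣p─q∣≡sumFin (inside ∷ p) (outside ∷ q) = cong suc (∣p─q∣≡sumFin p q)
∣p─q∣≡sumFin (outside ∷ p) (outside ∷ q) = ∣p─q∣≡sumFin p q

p[j]≔inside⊆q : {p q : Subset n} {j : Fin n} → p ⊆ q → j ∈ q → p [ j ]≔ inside ⊆ q
p[j]≔inside⊆q {p = p} {j = j} p⊆q j∈q {x} x∈p[j] with x Fin.≟ j
... | yes refl = j∈q
... | no x≢j = p⊆q (lookup⇒∈ (trans (sym (lookup∘update′ x≢j p inside)) (∈⇒lookup x∈p[j])))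

p[j]≔outside⊆p : (p : Subset n) (j : Fin n) → p [ j ]≔ outside ⊆ p
p[j]≔outside⊆p p j {x} x∈p[j] with x Fin.≟ j
... | yes refl with () ← trans (sym (lookup∘update j p outside)) (∈⇒lookup x∈p[j])
... | no x≢j = lookup⇒∈ (trans (sym (lookup∘update′ x≢j p outside)) (∈⇒lookup x∈p[j]))

∣p[j]≔outside∣ : (p : Subset n) {j : Fin n} → j ∈ p → suc ∣ p [ j ]≔ outside ∣ ≡ ∣ p ∣
∣p[j]≔outside∣ (inside ∷ p) here = refl
∣p[j]≔outside∣ (inside ∷ p) (there j∈p) = cong suc (∣p[j]≔outside∣ p j∈p)
∣p[j]≔outside∣ (outside ∷ p) (there j∈p) = ∣p[j]≔outside∣ p j∈p

intermediateSubset : (p q : Subset n) {k : ℕ} → p ⊆ q → ∣ p ∣ ≤ k → k ≤ ∣ q ∣ →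
                     ∃ λ w → p ⊆ w × w ⊆ q × ∣ w ∣ ≡ k
intermediateSubset [] [] {zero} _ _ _ = [] , ⊆-refl , ⊆-refl , refl
intermediateSubset (outside ∷ p) (outside ∷ q) p⊆q ∣p∣≤k k≤∣q∣
  with w , p⊆w , w⊆q , ∣w∣≡k ← intermediateSubset p q (drop-∷-⊆ p⊆q) ∣p∣≤k k≤∣q∣ =
  outside ∷ w , out⊆ p⊆w , out⊆ w⊆q , ∣w∣≡k
intermediateSubset (inside ∷ p) (inside ∷ q) {suc k} p⊆q (s≤s ∣p∣≤k) (s≤s k≤∣q∣)
  with w , p⊆w , w⊆q , ∣w∣≡k ← intermediateSubset p q (drop-∷-⊆ p⊆q) ∣p∣≤k k≤∣q∣ =
  inside ∷ w , in⊆in p⊆w , in⊆in w⊆q , cong suc ∣w∣≡k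
intermediateSubset (inside ∷ p) (outside ∷ q) p⊆q _ _ with () ← p⊆q here
intermediateSubset (outside ∷ p) (inside ∷ q) {k} p⊆q ∣p∣≤k k≤1+∣q∣ with k ≤? ∣ q ∣
... | yes k≤∣q∣
  with w , p⊆w , w⊆q , ∣w∣≡k ← intermediateSubset p q (drop-∷-⊆ p⊆q) ∣p∣≤k k≤∣q∣ =
  outside ∷ w , out⊆ p⊆w , out⊆ w⊆q , ∣w∣≡k
... | no k≰∣q∣ with k | ≤-antisym k≤1+∣q∣ (≰⇒> k≰∣q∣)
...   | .(suc ∣ q ∣) | refl = inside ∷ q , out⊆ (drop-∷-⊆ p⊆q) , ⊆-refl , refl

p─[q─r]∩q⊆r : (p q r : Subset n) → (p ─ (q ─ r)) ∩ q ⊆ r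
p─[q─r]∩q⊆r p q r {x} x∈ with x∈p∩q⁻ (p ─ (q ─ r)) q x∈ | x ∈? r
... | _ , _ | yes x∈r = x∈r
... | x∈p─[q─r] , x∈q | no x∉r = contradiction (x∈p∧x∉q⇒x∈p─q x∈q x∉r) (x∈p─q⇒x∉q p (q ─ r) x∈p─[q─r])

0<∣q─p∣ : {p q : Subset n} → p ⊆ q → ∣ p ∣ < ∣ q ∣ → 0 < ∣ q ─ p ∣
0<∣q─p∣ {p = p} {q} p⊆q ∣p∣<∣q∣ =
  subst (0 <_) (trans (cong (_∸ ∣ p ∣) (sym (∣p─q∣+∣q∣≡∣p∣ q p p⊆q))) (m+n∸n≡m ∣ q ─ p ∣ ∣ p ∣)) (m<n⇒0<n∸m ∣p∣<∣q∣)

x∈p⇒⁅x⁆⊆p : {x : Fin n} {p : Subset n} → x ∈ p → ⁅ x ⁆ ⊆ p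
x∈p⇒⁅x⁆⊆p {x = x} {p} x∈p y∈⁅x⁆ = subst (_∈ p) (sym (x∈⁅y⁆⇒x≡y x y∈⁅x⁆)) x∈p

nonempty : (p : Subset n) → 0 < ∣ p ∣ → Nonempty p
nonempty (inside ∷ p) _ = zero , here
nonempty (outside ∷ p) 0<∣p∣ with x , x∈p ← nonempty p 0<∣p∣ = suc x , there x∈p

-- Double counting and injections

sumSubsets-reindex-[]≔ : (j : Fin n) (g : Subset n → ℕ) →
  sumSubsets (λ Y → ⟦ not (lookup Y j) ⟧ * g Y) ≡ sumSubsets (λ Z → ⟦ lookup Z j ⟧ * g (Z [ j ]≔ outside))
sumSubsets-reindex-[]≔ {suc n} zero g = +-comm (sumSubsets {n} (λ _ → 0)) _
sumSubsets-reindex-[]≔ {suc n} (suc j) g =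
  cong₂ _+_ (sumSubsets-reindex-[]≔ j (g ∘ (inside ∷_))) (sumSubsets-reindex-[]≔ j (g ∘ (outside ∷_)))

-- Both sides sum w over the pairs (X, X + j) with j ∉ X.
sumSubsets-up≡down : (w : Subset n → Subset n → ℕ) →
  sumSubsets (λ X → sumFin (λ j → ⟦ not (lookup X j) ⟧ * w X (X [ j ]≔ inside))) ≡
  sumSubsets (λ Z → sumFin (λ j → ⟦ lookup Z j ⟧ * w (Z [ j ]≔ outside) Z))
sumSubsets-up≡down w = begin
  sumSubsets (λ X → sumFin (λ j → ⟦ not (lookup X j) ⟧ * w X (X [ j ]≔ inside)))
    ≡⟨ sumSubsets-sumFin-comm (λ X j → ⟦ not (lookup X j) ⟧ * w X (X [ j ]≔ inside)) ⟩
  sumFin (λ j → sumSubsets (λ X → ⟦ not (lookup X j) ⟧ * w X (X [ j ]≔ inside)))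
    ≡⟨ sumFin-cong (λ j → sumSubsets-reindex-[]≔ j (λ X → w X (X [ j ]≔ inside))) ⟩
  sumFin (λ j → sumSubsets (λ Z → ⟦ lookup Z j ⟧ * w (Z [ j ]≔ outside) (Z [ j ]≔ outside [ j ]≔ inside)))
    ≡⟨ sumFin-cong (λ j → sumSubsets-cong (reinsert j)) ⟩
  sumFin (λ j → sumSubsets (λ Z → ⟦ lookup Z j ⟧ * w (Z [ j ]≔ outside) Z))
    ≡⟨ sumSubsets-sumFin-comm (λ Z j → ⟦ lookup Z j ⟧ * w (Z [ j ]≔ outside) Z) ⟨
  sumSubsets (λ Z → sumFin (λ j → ⟦ lookup Z j ⟧ * w (Z [ j ]≔ outside) Z)) ∎
  where
  open ≡-Reasoning
  reinsert : ∀ j Z → ⟦ lookup Z j ⟧ * w (Z [ j ]≔ outside) (Z [ j ]≔ outside [ j ]≔ inside)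
                   ≡ ⟦ lookup Z j ⟧ * w (Z [ j ]≔ outside) Z
  reinsert j Z with lookup Z j in Z[j]
  ... | outside = refl
  ... | inside = cong (λ Z′ → 1 * w (Z [ j ]≔ outside) Z′) (begin
    Z [ j ]≔ outside [ j ]≔ inside ≡⟨ []≔-idempotent Z j ⟩
    Z [ j ]≔ inside                ≡⟨ cong (Z [ j ]≔_) Z[j] ⟨
    Z [ j ]≔ lookup Z j            ≡⟨ []≔-lookup Z j ⟩
    Z                              ∎)

sumSubsets-inside : (f : Subset (suc n) → ℕ) → (∀ X → f (outside ∷ X) ≡ 0) →
                    sumSubsets f ≡ sumSubsets (f ∘ (inside ∷_))
sumSubsets-inside {n} f f-outside≡0 = begin
  sumSubsets (f ∘ (inside ∷_)) + sumSubsets (f ∘ (outside ∷_)) ≡⟨ cong (sumSubsets (f ∘ (inside ∷_)) +_) (sumSubsets-cong f-outside≡0) ⟩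
  sumSubsets (f ∘ (inside ∷_)) + sumSubsets {n} (λ _ → 0)      ≡⟨ cong (sumSubsets (f ∘ (inside ∷_)) +_) (sumSubsets-zero {n}) ⟩
  sumSubsets (f ∘ (inside ∷_)) + 0                             ≡⟨ +-identityʳ _ ⟩
  sumSubsets (f ∘ (inside ∷_))                                 ∎
  where open ≡-Reasoning

¬inside⊆outside : {p q : Subset n} → ¬ (inside ∷ p ⊆ outside ∷ q)
¬inside⊆outside p⊆q with () ← p⊆q here

¬∷⊆∷ : {s t : Bool} {p q : Subset n} → ¬ p ⊆ q → ¬ (s ∷ p ⊆ t ∷ q)
¬∷⊆∷ p⊈q = p⊈q ∘ drop-∷-⊆

record RemovalBound (K : Subset n) (f g : Subset n → ℕ) : Set where
  constructor removalBound
  field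
    vanishes : ∀ X → ¬ K ⊆ X → f X ≡ 0
    bounded  : ∀ X → K ⊆ X → f X ≤ g (X ─ K)

module _ {K : Subset n} {f g : Subset (suc n) → ℕ} where

  removalBound-outside≡0 : RemovalBound (inside ∷ K) f g → ∀ X → f (outside ∷ X) ≡ 0
  removalBound-outside≡0 (removalBound f≡0 _) X = f≡0 (outside ∷ X) ¬inside⊆outside

  removalBound-inside : RemovalBound (inside ∷ K) f g → RemovalBound K (f ∘ (inside ∷_)) (g ∘ (outside ∷_))
  removalBound-inside (removalBound f≡0 f≤g) = removalBound (λ X → f≡0 _ ∘ ¬∷⊆∷) (λ X → f≤g _ ∘ in⊆in)

  removalBound-∷ : {s : Bool} → RemovalBound (outside ∷ K) f g → RemovalBound K (f ∘ (s ∷_)) (g ∘ (s ∷_))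
  removalBound-∷ (removalBound f≡0 f≤g) = removalBound (λ X → f≡0 _ ∘ ¬∷⊆∷) (λ X → f≤g _ ∘ out⊆)

-- X ↦ X ─ K is injective on the supersets of K.
sumSubsets-remove-≤ : (K : Subset n) {f g : Subset n → ℕ} → RemovalBound K f g → sumSubsets f ≤ sumSubsets g
sumSubsets-remove-≤ [] (removalBound _ f≤g) = f≤g [] ⊆-refl
sumSubsets-remove-≤ (inside ∷ K) {f} {g} bound = begin
  sumSubsets f                  ≡⟨ sumSubsets-inside f (removalBound-outside≡0 bound) ⟩
  sumSubsets (f ∘ (inside ∷_))  ≤⟨ sumSubsets-remove-≤ K (removalBound-inside bound) ⟩
  sumSubsets (g ∘ (outside ∷_)) ≤⟨ m≤n+m _ _ ⟩
  sumSubsets g                  ∎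
  where open ≤-Reasoning
sumSubsets-remove-≤ (outside ∷ K) bound =
  +-mono-≤ (sumSubsets-remove-≤ K (removalBound-∷ bound)) (sumSubsets-remove-≤ K (removalBound-∷ bound))

-- A set Y meeting K is not of the form X ─ K.
sumSubsets-remove-< : (K : Subset n) {f g : Subset n → ℕ} → RemovalBound K f g →
                      {u : Fin n} {Y : Subset n} → u ∈ K → u ∈ Y → 0 < g Y → sumSubsets f < sumSubsets g
sumSubsets-remove-< (inside ∷ K) {f} {g} bound {Y = inside ∷ Y} _ _ 0<gY = begin-strict
  sumSubsets f                  ≡⟨ sumSubsets-inside f (removalBound-outside≡0 bound) ⟩
  sumSubsets (f ∘ (inside ∷_))  ≤⟨ sumSubsets-remove-≤ K (removalBound-inside bound) ⟩
  sumSubsets (g ∘ (outside ∷_)) <⟨ m<n+m _ (sumSubsets-pos (g ∘ (inside ∷_)) Y 0<gY) ⟩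
  sumSubsets g                  ∎
  where open ≤-Reasoning
sumSubsets-remove-< (inside ∷ K) {f} {g} bound {Y = outside ∷ Y} (there u∈K) (there u∈Y) 0<gY = begin-strict
  sumSubsets f                  ≡⟨ sumSubsets-inside f (removalBound-outside≡0 bound) ⟩
  sumSubsets (f ∘ (inside ∷_))  <⟨ sumSubsets-remove-< K (removalBound-inside bound) u∈K u∈Y 0<gY ⟩
  sumSubsets (g ∘ (outside ∷_)) ≤⟨ m≤n+m _ _ ⟩
  sumSubsets g                  ∎
  where open ≤-Reasoning
sumSubsets-remove-< (outside ∷ K) bound {Y = inside ∷ Y} (there u∈K) (there u∈Y) 0<gY = +-mono-<-≤
  (sumSubsets-remove-< K (removalBound-∷ bound) u∈K u∈Y 0<gY) (sumSubsets-remove-≤ K (removalBound-∷ bound))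
sumSubsets-remove-< (outside ∷ K) bound {Y = outside ∷ Y} (there u∈K) (there u∈Y) 0<gY = +-mono-≤-<
  (sumSubsets-remove-≤ K (removalBound-∷ bound)) (sumSubsets-remove-< K (removalBound-∷ bound) u∈K u∈Y 0<gY)

∈-layer⁻ : (F : Family n) {k : ℕ} {X : Subset n} → X ∈F layer F k → X ∈F F × ∣ X ∣ ≡ k
∈-layer⁻ F {X = X} X∈ with X∈F , e ← ∧-true⁻ {F X} X∈ = X∈F , ⌊⌋-true⇒ (∣ X ∣ ≟ _) e

∈-layer⁺ : (F : Family n) {k : ℕ} {X : Subset n} → X ∈F F → ∣ X ∣ ≡ k → X ∈F layer F k
∈-layer⁺ F {X = X} X∈F ∣X∣≡k = cong₂ _∧_ X∈F (⌊⌋-true⇐ (∣ X ∣ ≟ _) ∣X∣≡k)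

∈-containing⁻ : (F : Family n) {T X : Subset n} → X ∈F containing F T → X ∈F F × T ⊆ X
∈-containing⁻ F {T} {X} X∈ with X∈F , e ← ∧-true⁻ {F X} X∈ = X∈F , ⌊⌋-true⇒ (T ⊆? X) e

∈-containing⁺ : (F : Family n) {T X : Subset n} → X ∈F F → T ⊆ X → X ∈F containing F T
∈-containing⁺ F {T} {X} X∈F T⊆X = cong₂ _∧_ X∈F (⌊⌋-true⇐ (T ⊆? X) T⊆X)

∈-containing-layer⁻ : (H : Family n) {k : ℕ} {I X : Subset n} → X ∈F containing (layer H k) I →
                      X ∈F H × ∣ X ∣ ≡ k × I ⊆ X
∈-containing-layer⁻ H X∈
  with X∈layer , I⊆X ← ∈-containing⁻ (layer H _) X∈
  with X∈H , ∣X∣≡k ← ∈-layer⁻ H X∈layer = X∈H , ∣X∣≡k , I⊆X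

∈-containing-layer⁺ : (H : Family n) {k : ℕ} {I X : Subset n} → X ∈F H → ∣ X ∣ ≡ k → I ⊆ X →
                      X ∈F containing (layer H k) I
∈-containing-layer⁺ H X∈H ∣X∣≡k I⊆X = ∈-containing⁺ (layer H _) (∈-layer⁺ H X∈H ∣X∣≡k) I⊆X

meetFamilyᶜ : Family n → ℕ → Subset n → ℕ → Family n
meetFamilyᶜ H s I t B = layer H s B ∧ not ⌊ t ≤? ∣ B ∩ I ∣ ⌋

∈-meetFamilyᶜ⁺ : (H : Family n) {s t : ℕ} {I Y : Subset n} → Y ∈F H → ∣ Y ∣ ≡ s → ∣ Y ∩ I ∣ < t →
                 Y ∈F meetFamilyᶜ H s I t
∈-meetFamilyᶜ⁺ H {t = t} {I} {Y} Y∈H ∣Y∣≡s ∣Y∩I∣<t =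
  cong₂ (λ a b → a ∧ not b) (∈-layer⁺ H Y∈H ∣Y∣≡s) (⌊⌋-false⇐ (t ≤? ∣ Y ∩ I ∣) (<⇒≱ ∣Y∩I∣<t))

card-layer-split : (H : Family n) (s : ℕ) (I : Subset n) (t : ℕ) →
                   card (layer H s) ≡ card (meetFamily H s I t) + card (meetFamilyᶜ H s I t)
card-layer-split H s I t = begin
  card (layer H s)                                                     ≡⟨ card≡sumSubsets (layer H s) ⟩
  sumSubsets (⟦_⟧ ∘ layer H s)                                         ≡⟨ sumSubsets-cong (λ X → split (layer H s X) _) ⟩
  sumSubsets (λ X → ⟦ meetFamily H s I t X ⟧ + ⟦ meetFamilyᶜ H s I t X ⟧) ≡⟨ sumSubsets-+ (⟦_⟧ ∘ meetFamily H s I t) _ ⟩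
  sumSubsets (⟦_⟧ ∘ meetFamily H s I t) + sumSubsets (⟦_⟧ ∘ meetFamilyᶜ H s I t)
    ≡⟨ cong₂ _+_ (card≡sumSubsets (meetFamily H s I t)) (card≡sumSubsets (meetFamilyᶜ H s I t)) ⟨
  card (meetFamily H s I t) + card (meetFamilyᶜ H s I t)               ∎
  where
  open ≡-Reasoning
  split : ∀ a b → ⟦ a ⟧ ≡ ⟦ a ∧ b ⟧ + ⟦ a ∧ not b ⟧
  split false _ = refl
  split true true = refl
  split true false = refl

argmin : {P : Subset n → Set} → U.Decidable P → (μ : Subset n → ℕ) → {X : Subset n} → P X →
         ∃ λ Y → P Y × (∀ W → P W → μ Y ≤ μ W)
argmin {n} {P} P? μ {X} pX = descend (μ X) X pX ≤-refl
  where
  descend : ∀ k X → P X → μ X ≤ k → ∃ λ Y → P Y × (∀ W → P W → μ Y ≤ μ W)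
  descend k X pX μX≤k with anySubset? (λ W → P? W ×-dec (μ W <? μ X))
  ... | no ∄smaller = X , pX , λ W pW → ≮⇒≥ (λ μW<μX → ∄smaller (W , pW , μW<μX))
  descend zero X pX μX≤0 | yes (W , _ , μW<μX) = contradiction (≤-trans μW<μX μX≤0) λ ()
  descend (suc k) X pX μX≤k | yes (W , pW , μW<μX) = descend k W pW (≤-pred (≤-trans μW<μX μX≤k))

extendToBase : (H : Family n) {X : Subset n} → X ∈F H → ∃ λ Z → X ⊆ Z × IsBase H Z
extendToBase H {X} X∈H
  with Z , (Z∈H , X⊆Z) , Z-max ← argmin (λ Z → (H Z ≟ᵇ true) ×-dec (X ⊆? Z)) (∣_∣ ∘ ∁) (X∈H , ⊆-refl) =
  Z , X⊆Z , Z∈H , λ A A∈H Z⊂A →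
    <⇒≱ (p⊂q⇒∣p∣<∣q∣ (p⊂q⇒∁p⊃∁q Z⊂A)) (Z-max A (A∈H , ⊆-trans X⊆Z (p⊂q⇒p⊆q Z⊂A)))

IsBase? : (H : Family n) → U.Decidable (IsBase H)
IsBase? H B = (H B ≟ᵇ true) ×-dec map′
  (λ ∄larger A A∈H B⊂A → ∄larger (A , A∈H , B⊂A))
  (λ no-larger (A , A∈H , B⊂A) → no-larger A A∈H B⊂A)
  (¬? (anySubset? (λ A → (H A ≟ᵇ true) ×-dec (B ⊂? A))))

μ-exists : (H : Family n) {X : Subset n} → X ∈F H → ∃ (IsMu H)
μ-exists H X∈H
  with _ , _ , Z-base ← extendToBase H X∈H
  with B , B-base , B-min ← argmin (IsBase? H) ∣_∣ Z-base =
  ∣ B ∣ , (B , B-base , refl) , B-min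

extensions : Family n → Subset n → ℕ
extensions H X = sumFin (λ j → ⟦ not (lookup X j) ⟧ * ⟦ H (X [ j ]≔ inside) ⟧)

∣Z∣∸∣X∣≤extensions : {H : Family n} → Hereditary H → {X Z : Subset n} → Z ∈F H → X ⊆ Z →
                     ∣ Z ∣ ∸ ∣ X ∣ ≤ extensions H X
∣Z∣∸∣X∣≤extensions {H = H} hered {X} {Z} Z∈H X⊆Z = begin
  ∣ Z ∣ ∸ ∣ X ∣                ≡⟨ cong (_∸ ∣ X ∣) (∣p─q∣+∣q∣≡∣p∣ Z X X⊆Z) ⟨
  ∣ Z ─ X ∣ + ∣ X ∣ ∸ ∣ X ∣    ≡⟨ m+n∸n≡m ∣ Z ─ X ∣ ∣ X ∣ ⟩
  ∣ Z ─ X ∣                    ≡⟨ ∣p─q∣≡sumFin Z X ⟩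
  sumFin (λ j → ⟦ not (lookup X j) ⟧ * ⟦ lookup Z j ⟧) ≤⟨ sumFin-mono-≤ addable ⟩
  extensions H X               ∎
  where
  open ≤-Reasoning
  addable : ∀ j → ⟦ not (lookup X j) ⟧ * ⟦ lookup Z j ⟧ ≤ ⟦ not (lookup X j) ⟧ * ⟦ H (X [ j ]≔ inside) ⟧
  addable j with lookup X j | lookup Z j in Z[j]
  ... | inside | _ = z≤n
  ... | outside | outside = z≤n
  ... | outside | inside
    rewrite hered Z (X [ j ]≔ inside) Z∈H (p[j]≔inside⊆q X⊆Z (lookup⇒∈ Z[j])) = ≤-refl

-- Binomially monotone sequences

m∸n≡1+[m∸1+n] : ∀ {m k} → k < m → m ∸ k ≡ suc (m ∸ suc k)
m∸n≡1+[m∸1+n] {suc m} {zero} _ = refl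
m∸n≡1+[m∸1+n] {suc m} {suc k} (s≤s k<m) = m∸n≡1+[m∸1+n] k<m

-- z k / (m choose k) is nondecreasing in k ≤ m.
BinomialStep : ℕ → (ℕ → ℕ) → Set
BinomialStep m z = ∀ k → (m ∸ k) * z k ≤ suc k * z (suc k)

module _ {m : ℕ} {z : ℕ → ℕ} (step : BinomialStep m z) where

  binomialStep-weighted-mono : ∀ {a b} → a ≤ b → b ≤ m → a ! * ((m ∸ a) ! * z a) ≤ b ! * ((m ∸ b) ! * z b)
  binomialStep-weighted-mono {b = zero} z≤n _ = ≤-refl
  binomialStep-weighted-mono {a} {suc b} a≤1+b 1+b≤m with m≤n⇒m<n∨m≡n a≤1+b
  ... | inj₂ refl = ≤-refl
  ... | inj₁ (s≤s a≤b) = ≤-trans (binomialStep-weighted-mono a≤b (<⇒≤ 1+b≤m)) (weighted-step 1+b≤m)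
    where
    weighted-step : ∀ {k} → k < m → k ! * ((m ∸ k) ! * z k) ≤ suc k ! * ((m ∸ suc k) ! * z (suc k))
    weighted-step {k} k<m = begin
      k ! * ((m ∸ k) ! * z k)             ≡⟨ cong (λ l → k ! * (l ! * z k)) m∸k≡1+c ⟩
      k ! * ((suc c * c !) * z k)         ≡⟨ regroup (k !) (c !) c (z k) ⟩
      (k ! * c !) * (suc c * z k)         ≤⟨ *-monoʳ-≤ (k ! * c !) (subst (λ l → l * z k ≤ suc k * z (suc k)) m∸k≡1+c (step k)) ⟩
      (k ! * c !) * (suc k * z (suc k))   ≡⟨ regroup′ (k !) (c !) k (z (suc k)) ⟩
      (suc k * k !) * (c ! * z (suc k))   ∎
      where
      open ≤-Reasoning
      c = m ∸ suc k
      m∸k≡1+c : m ∸ k ≡ suc c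
      m∸k≡1+c = m∸n≡1+[m∸1+n] k<m
      regroup : ∀ K C c x → K * ((suc c * C) * x) ≡ (K * C) * (suc c * x)
      regroup = solve-∀
      regroup′ : ∀ K C k y → (K * C) * (suc k * y) ≡ (suc k * K) * (C * y)
      regroup′ = solve-∀

binomialStep-≤ : {a b : ℕ} {z : ℕ → ℕ} → BinomialStep (a + b) z → a ≤ b → z a ≤ z b
binomialStep-≤ {a} {b} {z} step a≤b = *-cancelˡ-≤ (a ! * b !) {{a !* b !≢0}} (begin
  (a ! * b !) * z a            ≡⟨ *-assoc (a !) (b !) (z a) ⟩
  a ! * (b ! * z a)            ≡⟨ cong (λ l → a ! * (l ! * z a)) (m+n∸m≡n a b) ⟨
  a ! * ((a + b ∸ a) ! * z a)  ≤⟨ binomialStep-weighted-mono step a≤b (m≤n+m b a) ⟩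
  b ! * ((a + b ∸ b) ! * z b)  ≡⟨ cong (λ l → b ! * (l ! * z b)) (m+n∸n≡m a b) ⟩
  b ! * (a ! * z b)            ≡⟨ m*[n*o]≡n*[m*o] (b !) (a !) (z b) ⟩
  a ! * (b ! * z b)            ≡⟨ *-assoc (a !) (b !) (z b) ⟨
  (a ! * b !) * z b            ∎)
  where open ≤-Reasoning

binomialStep-< : {a b : ℕ} {z : ℕ → ℕ} → BinomialStep (suc (a + b)) z → a ≤ b → suc b * z a ≤ suc a * z b
binomialStep-< {a} {b} {z} step a≤b = *-cancelˡ-≤ (a ! * b !) {{a !* b !≢0}} (begin
  (a ! * b !) * (suc b * z a)        ≡⟨ regroup (a !) (b !) b (z a) ⟩
  a ! * ((suc b * b !) * z a)        ≡⟨ cong (λ l → a ! * (l ! * z a)) (m+n∸m≡n a (suc b)) ⟨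
  a ! * ((a + suc b ∸ a) ! * z a)    ≡⟨ cong (λ l → a ! * ((l ∸ a) ! * z a)) (+-suc a b) ⟩
  a ! * ((suc (a + b) ∸ a) ! * z a)  ≤⟨ binomialStep-weighted-mono step a≤b (m≤n+m b (suc a)) ⟩
  b ! * ((suc (a + b) ∸ b) ! * z b)  ≡⟨ cong (λ l → b ! * (l ! * z b)) (m+n∸n≡m (suc a) b) ⟩
  b ! * ((suc a * a !) * z b)        ≡⟨ regroup (b !) (a !) a (z b) ⟨
  (b ! * a !) * (suc a * z b)        ≡⟨ cong (_* (suc a * z b)) (*-comm (b !) (a !)) ⟩
  (a ! * b !) * (suc a * z b)        ∎)
  where
  open ≤-Reasoning
  regroup : ∀ A B b x → (A * B) * (suc b * x) ≡ A * ((suc b * B) * x)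
  regroup = solve-∀

-- Shadows of H^(k)(I)

module _ {H : Family n} (hered : Hereditary H) (I : Subset n) where

  private
    A : ℕ → Family n
    A k = containing (layer H k) I

    ∈-A⁻ : ∀ {k X} → X ∈F A k → X ∈F H × ∣ X ∣ ≡ k × I ⊆ X
    ∈-A⁻ = ∈-containing-layer⁻ H

    ∈-A⁺ : ∀ {k X} → X ∈F H → ∣ X ∣ ≡ k → I ⊆ X → X ∈F A k
    ∈-A⁺ = ∈-containing-layer⁺ H

  ∈-A-reinsert : ∀ {k Z j} → Z ∈F H → j ∈ Z → (Z [ j ]≔ outside) ∈F A k →
                 Z ∈F A (suc k) × lookup I j ≡ outside
  ∈-A-reinsert {Z = Z} {j} Z∈H j∈Z Z-j∈
    with _ , ∣Z-j∣≡k , I⊆Z-j ← ∈-A⁻ Z-j∈ =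
    ∈-A⁺ Z∈H (trans (sym (∣p[j]≔outside∣ Z j∈Z)) (cong suc ∣Z-j∣≡k)) (⊆-trans I⊆Z-j (p[j]≔outside⊆p Z j)) ,
    ∉⇒lookup (j∉p[j]≔outside Z j ∘ I⊆Z-j)

  -- Double counting of the pairs X ⊂ Z = X + j with X ∈ H^(k)(I) and Z ∈ H.
  card-shadow-step : (M : ℕ) → (∀ Z → IsBase H Z → M ≤ ∣ Z ∣) →
    ∀ k → (M ∸ k) * card (A k) ≤ (suc k ∸ ∣ I ∣) * card (A (suc k))
  card-shadow-step M bases≥M k = begin
    (M ∸ k) * card (A k)
      ≡⟨ cong ((M ∸ k) *_) (card≡sumSubsets (A k)) ⟩
    (M ∸ k) * sumSubsets (⟦_⟧ ∘ A k)
      ≡⟨ sumSubsets-* (M ∸ k) (⟦_⟧ ∘ A k) ⟨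
    sumSubsets (λ X → (M ∸ k) * ⟦ A k X ⟧)
      ≤⟨ sumSubsets-mono-≤ up-degree ⟩
    sumSubsets (λ X → ⟦ A k X ⟧ * extensions H X)
      ≡⟨ sumSubsets-cong factor-out ⟩
    sumSubsets (λ X → sumFin (λ j → ⟦ not (lookup X j) ⟧ * w X (X [ j ]≔ inside)))
      ≡⟨ sumSubsets-up≡down w ⟩
    sumSubsets (λ Z → sumFin (λ j → ⟦ lookup Z j ⟧ * w (Z [ j ]≔ outside) Z))
      ≤⟨ sumSubsets-mono-≤ down-degree ⟩
    sumSubsets (λ Z → ⟦ A (suc k) Z ⟧ * ∣ Z ─ I ∣)
      ≡⟨ sumSubsets-cong new-elements ⟩
    sumSubsets (λ Z → (suc k ∸ ∣ I ∣) * ⟦ A (suc k) Z ⟧)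
      ≡⟨ sumSubsets-* (suc k ∸ ∣ I ∣) (⟦_⟧ ∘ A (suc k)) ⟩
    (suc k ∸ ∣ I ∣) * sumSubsets (⟦_⟧ ∘ A (suc k))
      ≡⟨ cong ((suc k ∸ ∣ I ∣) *_) (card≡sumSubsets (A (suc k))) ⟨
    (suc k ∸ ∣ I ∣) * card (A (suc k)) ∎
    where
    open ≤-Reasoning

    w : Subset n → Subset n → ℕ
    w X Z = ⟦ A k X ⟧ * ⟦ H Z ⟧

    factor-out : ∀ X → ⟦ A k X ⟧ * extensions H X ≡ sumFin (λ j → ⟦ not (lookup X j) ⟧ * w X (X [ j ]≔ inside))
    factor-out X = begin-equality
      ⟦ A k X ⟧ * extensions H X
        ≡⟨ sumFin-* ⟦ A k X ⟧ (λ j → ⟦ not (lookup X j) ⟧ * ⟦ H (X [ j ]≔ inside) ⟧) ⟨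
      sumFin (λ j → ⟦ A k X ⟧ * (⟦ not (lookup X j) ⟧ * ⟦ H (X [ j ]≔ inside) ⟧))
        ≡⟨ sumFin-cong (λ j → m*[n*o]≡n*[m*o] ⟦ A k X ⟧ ⟦ not (lookup X j) ⟧ ⟦ H (X [ j ]≔ inside) ⟧) ⟩
      sumFin (λ j → ⟦ not (lookup X j) ⟧ * w X (X [ j ]≔ inside)) ∎

    up-degree : ∀ X → (M ∸ k) * ⟦ A k X ⟧ ≤ ⟦ A k X ⟧ * extensions H X
    up-degree X with A k X in X∈
    ... | false = ≤-reflexive (*-zeroʳ (M ∸ k))
    ... | true
      with X∈H , ∣X∣≡k , _ ← ∈-A⁻ X∈
      with Z , X⊆Z , Z-base ← extendToBase H X∈H = begin
        (M ∸ k) * 1               ≡⟨ *-identityʳ (M ∸ k) ⟩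
        M ∸ k                     ≤⟨ ∸-monoˡ-≤ k (bases≥M Z Z-base) ⟩
        ∣ Z ∣ ∸ k                 ≡⟨ cong (∣ Z ∣ ∸_) ∣X∣≡k ⟨
        ∣ Z ∣ ∸ ∣ X ∣             ≤⟨ ∣Z∣∸∣X∣≤extensions hered (proj₁ Z-base) X⊆Z ⟩
        extensions H X            ≡⟨ *-identityˡ (extensions H X) ⟨
        1 * extensions H X        ∎

    down-edge : ∀ Z j → ⟦ lookup Z j ⟧ * w (Z [ j ]≔ outside) Z ≤
                        ⟦ A (suc k) Z ⟧ * (⟦ not (lookup I j) ⟧ * ⟦ lookup Z j ⟧)
    down-edge Z j = ⟦⟧-*-≤ {lookup Z j} {A k (Z [ j ]≔ outside)} {H Z} {A (suc k) Z} {lookup I j}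
      λ j∈Z Z-j∈ Z∈H → ∈-A-reinsert Z∈H (lookup⇒∈ j∈Z) Z-j∈

    down-degree : ∀ Z → sumFin (λ j → ⟦ lookup Z j ⟧ * w (Z [ j ]≔ outside) Z) ≤ ⟦ A (suc k) Z ⟧ * ∣ Z ─ I ∣
    down-degree Z = begin
      sumFin (λ j → ⟦ lookup Z j ⟧ * w (Z [ j ]≔ outside) Z)                       ≤⟨ sumFin-mono-≤ (down-edge Z) ⟩
      sumFin (λ j → ⟦ A (suc k) Z ⟧ * (⟦ not (lookup I j) ⟧ * ⟦ lookup Z j ⟧))     ≡⟨ sumFin-* ⟦ A (suc k) Z ⟧ (λ j → ⟦ not (lookup I j) ⟧ * ⟦ lookup Z j ⟧) ⟩
      ⟦ A (suc k) Z ⟧ * sumFin (λ j → ⟦ not (lookup I j) ⟧ * ⟦ lookup Z j ⟧)       ≡⟨ cong (⟦ A (suc k) Z ⟧ *_) (∣p─q∣≡sumFin Z I) ⟨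
      ⟦ A (suc k) Z ⟧ * ∣ Z ─ I ∣                                                  ∎

    new-elements : ∀ Z → ⟦ A (suc k) Z ⟧ * ∣ Z ─ I ∣ ≡ (suc k ∸ ∣ I ∣) * ⟦ A (suc k) Z ⟧
    new-elements Z with A (suc k) Z in Z∈
    ... | false = sym (*-zeroʳ (suc k ∸ ∣ I ∣))
    ... | true with _ , ∣Z∣≡1+k , I⊆Z ← ∈-A⁻ Z∈ = begin-equality
      1 * ∣ Z ─ I ∣                    ≡⟨ *-identityˡ _ ⟩
      ∣ Z ─ I ∣                        ≡⟨ m+n∸n≡m ∣ Z ─ I ∣ ∣ I ∣ ⟨
      ∣ Z ─ I ∣ + ∣ I ∣ ∸ ∣ I ∣        ≡⟨ cong (_∸ ∣ I ∣) (trans (∣p─q∣+∣q∣≡∣p∣ Z I I⊆Z) ∣Z∣≡1+k) ⟩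
      suc k ∸ ∣ I ∣                    ≡⟨ *-identityʳ _ ⟨
      (suc k ∸ ∣ I ∣) * 1              ∎

  card-shadow-binomialStep : {m : ℕ} → (∀ Z → IsBase H Z → ∣ I ∣ + m ≤ ∣ Z ∣) →
                             BinomialStep m (λ a → card (A (∣ I ∣ + a)))
  card-shadow-binomialStep {m} bases≥ a = begin
    (m ∸ a) * card (A (∣ I ∣ + a))
      ≡⟨ cong (_* card (A (∣ I ∣ + a))) ([m+n]∸[m+o]≡n∸o ∣ I ∣ m a) ⟨
    (∣ I ∣ + m ∸ (∣ I ∣ + a)) * card (A (∣ I ∣ + a))
      ≤⟨ card-shadow-step (∣ I ∣ + m) bases≥ (∣ I ∣ + a) ⟩
    (suc (∣ I ∣ + a) ∸ ∣ I ∣) * card (A (suc (∣ I ∣ + a)))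
      ≡⟨ cong (λ l → (l ∸ ∣ I ∣) * card (A l)) (+-suc ∣ I ∣ a) ⟨
    (∣ I ∣ + suc a ∸ ∣ I ∣) * card (A (∣ I ∣ + suc a))
      ≡⟨ cong (_* card (A (∣ I ∣ + suc a))) (m+n∸m≡n ∣ I ∣ (suc a)) ⟩
    suc a * card (A (∣ I ∣ + suc a)) ∎
    where open ≤-Reasoning

  X─[I─J]∈meetFamilyᶜ : ∀ {J X b} → J ⊆ I → X ∈F A (∣ I ∣ + b) →
                        (X ─ (I ─ J)) ∈F meetFamilyᶜ H (b + ∣ J ∣) I (suc ∣ J ∣)
  X─[I─J]∈meetFamilyᶜ {J} {X} {b} J⊆I X∈A with X∈H , ∣X∣≡i+b , I⊆X ← ∈-A⁻ X∈A =
    ∈-meetFamilyᶜ⁺ H (hered X Y X∈H (p─q⊆p X K)) (+-cancelʳ-≡ ∣ K ∣ ∣ Y ∣ (b + ∣ J ∣) sizes)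
      (s≤s (p⊆q⇒∣p∣≤∣q∣ (p─[q─r]∩q⊆r X I J)))
    where
    K = I ─ J
    Y = X ─ K
    sizes : ∣ Y ∣ + ∣ K ∣ ≡ b + ∣ J ∣ + ∣ K ∣
    sizes = begin
      ∣ Y ∣ + ∣ K ∣             ≡⟨ ∣p─q∣+∣q∣≡∣p∣ X K (⊆-trans (p─q⊆p I J) I⊆X) ⟩
      ∣ X ∣                     ≡⟨ ∣X∣≡i+b ⟩
      ∣ I ∣ + b                 ≡⟨ cong (_+ b) (∣p─q∣+∣q∣≡∣p∣ I J J⊆I) ⟨
      ∣ K ∣ + ∣ J ∣ + b         ≡⟨ reorder ∣ K ∣ ∣ J ∣ b ⟩
      b + ∣ J ∣ + ∣ K ∣         ∎
      where
      open ≡-Reasoning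
      reorder : ∀ k j b → k + j + b ≡ b + j + k
      reorder = solve-∀

  removalBound-A : ∀ {J b} → J ⊆ I →
    RemovalBound (I ─ J) (⟦_⟧ ∘ A (∣ I ∣ + b)) (⟦_⟧ ∘ meetFamilyᶜ H (b + ∣ J ∣) I (suc ∣ J ∣))
  removalBound-A {J} J⊆I = removalBound
    (λ X I─J⊈X → ⟦⟧-false λ X∈A → I─J⊈X (⊆-trans (p─q⊆p I J) (proj₂ (proj₂ (∈-A⁻ X∈A)))))
    (λ X _ → ⟦⟧-mono (X─[I─J]∈meetFamilyᶜ J⊆I))

  card-A≤card-meetFamilyᶜ : ∀ {J b} → J ⊆ I →
    card (A (∣ I ∣ + b)) ≤ card (meetFamilyᶜ H (b + ∣ J ∣) I (suc ∣ J ∣))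
  card-A≤card-meetFamilyᶜ {J} {b} J⊆I = begin
    card (A (∣ I ∣ + b))                         ≡⟨ card≡sumSubsets (A (∣ I ∣ + b)) ⟩
    sumSubsets (⟦_⟧ ∘ A (∣ I ∣ + b))             ≤⟨ sumSubsets-remove-≤ (I ─ J) (removalBound-A J⊆I) ⟩
    sumSubsets (⟦_⟧ ∘ meetFamilyᶜ H (b + ∣ J ∣) I (suc ∣ J ∣)) ≡⟨ card≡sumSubsets (meetFamilyᶜ H (b + ∣ J ∣) I (suc ∣ J ∣)) ⟨
    card (meetFamilyᶜ H (b + ∣ J ∣) I (suc ∣ J ∣)) ∎
    where open ≤-Reasoning

  -- Replacing J by a J′ containing some u ∈ I ─ J gives a member X ─ (I ─ J′) that meets I ─ J.
  card-A<card-meetFamilyᶜ : ∀ {J b X} → J ⊆ I → 0 < ∣ J ∣ → ∣ J ∣ < ∣ I ∣ → X ∈F A (∣ I ∣ + b) →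
    card (A (∣ I ∣ + b)) < card (meetFamilyᶜ H (b + ∣ J ∣) I (suc ∣ J ∣))
  card-A<card-meetFamilyᶜ {J} {b} {X} J⊆I 0<∣J∣ ∣J∣<∣I∣ X∈A
    with u , u∈I─J ← nonempty (I ─ J) (0<∣q─p∣ J⊆I ∣J∣<∣I∣)
    with J′ , ⁅u⁆⊆J′ , J′⊆I , ∣J′∣≡∣J∣ ← intermediateSubset ⁅ u ⁆ I (x∈p⇒⁅x⁆⊆p (p─q⊆p I J u∈I─J))
                                           (subst (_≤ ∣ J ∣) (sym (∣⁅x⁆∣≡1 u)) 0<∣J∣) (<⇒≤ ∣J∣<∣I∣) = begin-strict
    card (A (∣ I ∣ + b))                         ≡⟨ card≡sumSubsets (A (∣ I ∣ + b)) ⟩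
    sumSubsets (⟦_⟧ ∘ A (∣ I ∣ + b))             <⟨ sumSubsets-remove-< (I ─ J) (removalBound-A J⊆I)
                                                      u∈I─J u∈Y (≤-reflexive (cong ⟦_⟧ (sym Y∈))) ⟩
    sumSubsets (⟦_⟧ ∘ meetFamilyᶜ H (b + ∣ J ∣) I (suc ∣ J ∣)) ≡⟨ card≡sumSubsets (meetFamilyᶜ H (b + ∣ J ∣) I (suc ∣ J ∣)) ⟨
    card (meetFamilyᶜ H (b + ∣ J ∣) I (suc ∣ J ∣)) ∎
    where
    open ≤-Reasoning
    Y = X ─ (I ─ J′)
    Y∈ : Y ∈F meetFamilyᶜ H (b + ∣ J ∣) I (suc ∣ J ∣)
    Y∈ = subst (λ j → Y ∈F meetFamilyᶜ H (b + j) I (suc j)) ∣J′∣≡∣J∣ (X─[I─J]∈meetFamilyᶜ J′⊆I X∈A)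
    u∈Y : u ∈ Y
    u∈Y = x∈p∧x∉q⇒x∈p─q (proj₂ (proj₂ (∈-A⁻ X∈A)) (p─q⊆p I J u∈I─J))
                         (λ u∈I─J′ → x∈p─q⇒x∉q I J′ u∈I─J′ (⁅u⁆⊆J′ (x∈⁅x⁆ u)))

  card-A-mono : ∀ {a b} → (∀ Z → IsBase H Z → ∣ I ∣ + (a + b) ≤ ∣ Z ∣) → a ≤ b →
                card (A (∣ I ∣ + a)) ≤ card (A (∣ I ∣ + b))
  card-A-mono bases≥ = binomialStep-≤ (card-shadow-binomialStep bases≥)

  card-A-mono-strict : ∀ {a b} → (∀ Z → IsBase H Z → ∣ I ∣ + suc (a + b) ≤ ∣ Z ∣) → a ≤ b →
                       suc b * card (A (∣ I ∣ + a)) ≤ suc a * card (A (∣ I ∣ + b))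
  card-A-mono-strict bases≥ = binomialStep-< (card-shadow-binomialStep bases≥)

  ∃-∈-A : ∀ {m k} → I ∈F H → (∀ Z → IsBase H Z → ∣ I ∣ + m ≤ ∣ Z ∣) → k ≤ m → ∃ λ X → X ∈F A (∣ I ∣ + k)
  ∃-∈-A {m} {k} I∈H bases≥ k≤m
    with Z , I⊆Z , Z∈H , Z-max ← extendToBase H I∈H
    with X , I⊆X , X⊆Z , ∣X∣≡ ← intermediateSubset I Z I⊆Z (m≤m+n ∣ I ∣ k)
                                  (≤-trans (+-monoʳ-≤ ∣ I ∣ k≤m) (bases≥ Z (Z∈H , Z-max))) =
    X , ∈-A⁺ (hered Z X Z∈H X⊆Z) ∣X∣≡ I⊆X

module Setting {n t′ r s m : ℕ} {H : Family n} (hered : Hereditary H) {I : Subset n} (I∈H : I ∈F H)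
         (t≤∣I∣ : suc t′ ≤ ∣ I ∣) (∣I∣≤r : ∣ I ∣ ≤ r) (r≤s : r ≤ s)
         (μ≡m : IsMu H m) (μ≥ : r + s ∸ suc t′ + 1 ≤ m) where

  private
    A : ℕ → Family n
    A k = containing (layer H k) I

    B Bᶜ : Family n
    B = meetFamily H s I (suc t′)
    Bᶜ = meetFamilyᶜ H s I (suc t′)

    a b : ℕ
    a = r ∸ ∣ I ∣
    b = s ∸ t′

    t≤s : suc t′ ≤ s
    t≤s = ≤-trans t≤∣I∣ (≤-trans ∣I∣≤r r≤s)

    t′≤s : t′ ≤ s
    t′≤s = <⇒≤ t≤s

    ∣I∣+a≡r : ∣ I ∣ + a ≡ r
    ∣I∣+a≡r = m+[n∸m]≡n ∣I∣≤r

    b+t′≡s : b + t′ ≡ s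
    b+t′≡s = m∸n+n≡m t′≤s

    a<b : a < b
    a<b = +-cancelʳ-< t′ a b (begin-strict
      a + t′       <⟨ +-monoʳ-< a t≤∣I∣ ⟩
      a + ∣ I ∣    ≡⟨ trans (+-comm a ∣ I ∣) ∣I∣+a≡r ⟩
      r            ≤⟨ r≤s ⟩
      s            ≡⟨ b+t′≡s ⟨
      b + t′       ∎)
      where open ≤-Reasoning

    ∣I∣+[a+b]≡r+s∸t′ : ∣ I ∣ + (a + b) ≡ r + s ∸ t′
    ∣I∣+[a+b]≡r+s∸t′ = sym (begin
      r + s ∸ t′             ≡⟨ +-∸-assoc r t′≤s ⟩
      r + b                  ≡⟨ cong (_+ b) ∣I∣+a≡r ⟨
      ∣ I ∣ + a + b          ≡⟨ +-assoc ∣ I ∣ a b ⟩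
      ∣ I ∣ + (a + b)        ∎)
      where open ≡-Reasoning

    ∣I∣+[a+b]≤m : ∣ I ∣ + (a + b) ≤ m
    ∣I∣+[a+b]≤m = begin
      ∣ I ∣ + (a + b)       ≡⟨ ∣I∣+[a+b]≡r+s∸t′ ⟩
      r + s ∸ t′            ≡⟨ m∸n≡1+[m∸1+n] (≤-trans t≤s (m≤n+m s r)) ⟩
      suc (r + s ∸ suc t′)  ≡⟨ +-comm 1 _ ⟩
      r + s ∸ suc t′ + 1    ≤⟨ μ≥ ⟩
      m                     ∎
      where open ≤-Reasoning

    bases≥ : ∀ Z → IsBase H Z → ∣ I ∣ + (a + b) ≤ ∣ Z ∣
    bases≥ Z Z-base = ≤-trans ∣I∣+[a+b]≤m (proj₂ μ≡m Z Z-base)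

    ∃J : ∃ λ J → J ⊆ I × ∣ J ∣ ≡ t′
    ∃J with J , _ , J⊆I , ∣J∣≡t′ ← intermediateSubset ⊥ I (⊆-min I) (subst (_≤ t′) (sym (∣⊥∣≡0 n)) z≤n)
                                                        (≤-trans (n≤1+n t′) t≤∣I∣) =
      J , J⊆I , ∣J∣≡t′

    meetFamilyᶜ-J≡Bᶜ : {J : Subset n} → ∣ J ∣ ≡ t′ → meetFamilyᶜ H (b + ∣ J ∣) I (suc ∣ J ∣) ≡ Bᶜ
    meetFamilyᶜ-J≡Bᶜ ∣J∣≡t′ = trans (cong (λ j → meetFamilyᶜ H (b + j) I (suc j)) ∣J∣≡t′)
                                    (cong (λ s′ → meetFamilyᶜ H s′ I (suc t′)) b+t′≡s)

    card-A[r]≤card-A[∣I∣+b] : card (A r) ≤ card (A (∣ I ∣ + b))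
    card-A[r]≤card-A[∣I∣+b] = subst (λ k → card (A k) ≤ card (A (∣ I ∣ + b))) ∣I∣+a≡r
                                     (card-A-mono hered I bases≥ (<⇒≤ a<b))

    card-A[∣I∣+b]≤card-Bᶜ : card (A (∣ I ∣ + b)) ≤ card Bᶜ
    card-A[∣I∣+b]≤card-Bᶜ with J , J⊆I , ∣J∣≡t′ ← ∃J =
      subst (λ F → card (A (∣ I ∣ + b)) ≤ card F) (meetFamilyᶜ-J≡Bᶜ {J} ∣J∣≡t′)
            (card-A≤card-meetFamilyᶜ hered I J⊆I)

    card-A[∣I∣+b]<card-Bᶜ : 0 < t′ → card (A (∣ I ∣ + b)) < card Bᶜ
    card-A[∣I∣+b]<card-Bᶜ 0<t′
      with J , J⊆I , ∣J∣≡t′ ← ∃J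
      with X , X∈A ← ∃-∈-A hered I I∈H bases≥ (m≤n+m b a) =
      subst (λ F → card (A (∣ I ∣ + b)) < card F) (meetFamilyᶜ-J≡Bᶜ {J} ∣J∣≡t′)
        (card-A<card-meetFamilyᶜ hered I J⊆I (subst (0 <_) (sym ∣J∣≡t′) 0<t′)
                                             (subst (_< ∣ I ∣) (sym ∣J∣≡t′) t≤∣I∣) X∈A)

    card-layer≡ : card (layer H s) ≡ card Bᶜ + card B
    card-layer≡ = trans (card-layer-split H s I (suc t′)) (+-comm (card B) (card Bᶜ))

  card-A+card-B≤card-layer : card (A r) + card B ≤ card (layer H s)
  card-A+card-B≤card-layer = begin
    card (A r) + card B  ≤⟨ +-monoˡ-≤ (card B) (≤-trans card-A[r]≤card-A[∣I∣+b] card-A[∣I∣+b]≤card-Bᶜ) ⟩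
    card Bᶜ + card B     ≡⟨ card-layer≡ ⟨
    card (layer H s)     ∎
    where open ≤-Reasoning

  module _ (equality : card (A r) + card B ≡ card (layer H s)) where

    equality⇒t′≡0 : t′ ≡ 0
    equality⇒t′≡0 = n≤0⇒n≡0 (≮⇒≥ λ 0<t′ → <-irrefl equality (begin-strict
      card (A r) + card B  ≤⟨ +-monoˡ-≤ (card B) card-A[r]≤card-A[∣I∣+b] ⟩
      card (A (∣ I ∣ + b)) + card B  <⟨ +-monoˡ-< (card B) (card-A[∣I∣+b]<card-Bᶜ 0<t′) ⟩
      card Bᶜ + card B     ≡⟨ card-layer≡ ⟨
      card (layer H s)     ∎))
      where open ≤-Reasoning

    -- If μ(H) exceeded r + s, the strict form of the shadow inequality would force b ≤ a.
    equality⇒m≡r+s∸t′ : m ≡ r + s ∸ t′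
    equality⇒m≡r+s∸t′ = trans (≤-antisym m≤ ∣I∣+[a+b]≤m) ∣I∣+[a+b]≡r+s∸t′
      where
      card-A[r]≡card-Bᶜ : card (A r) ≡ card Bᶜ
      card-A[r]≡card-Bᶜ = +-cancelʳ-≡ (card B) _ _ (trans equality card-layer≡)

      0<card-A[r] : 0 < card (A r)
      0<card-A[r] with X , X∈A ← ∃-∈-A hered I I∈H bases≥ (m≤m+n a b) =
        card-pos (A r) (subst (λ k → X ∈F A k) ∣I∣+a≡r X∈A)

      m≤ : m ≤ ∣ I ∣ + (a + b)
      m≤ = ≮⇒≥ λ ∣I∣+[a+b]<m → <⇒≱ a<b (≤-pred (*-cancelʳ-≤ (suc b) (suc a) (card (A r)) {{>-nonZero 0<card-A[r]}} (begin
        suc b * card (A r)              ≡⟨ cong (λ k → suc b * card (A k)) ∣I∣+a≡r ⟨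
        suc b * card (A (∣ I ∣ + a))    ≤⟨ card-A-mono-strict hered I (λ Z Z-base → ≤-trans (≤-reflexive (+-suc ∣ I ∣ (a + b)))
                                             (≤-trans ∣I∣+[a+b]<m (proj₂ μ≡m Z Z-base))) (<⇒≤ a<b) ⟩
        suc a * card (A (∣ I ∣ + b))    ≤⟨ *-monoʳ-≤ (suc a) card-A[∣I∣+b]≤card-Bᶜ ⟩
        suc a * card Bᶜ                 ≡⟨ cong (suc a *_) card-A[r]≡card-Bᶜ ⟨
        suc a * card (A r)              ∎)))
        where open ≤-Reasoning

lemma1p10 : (n t r s : ℕ) → 1 ≤ t → t ≤ r → r ≤ s →
    (H : Family n) → Hereditary H →
    ((m : ℕ) → IsMu H m → r + s ∸ t + 1 ≤ m) →
    (I : Subset n) → I ∈F H → t ≤ ∣ I ∣ → ∣ I ∣ ≤ r →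
    (card (containing (layer H r) I) + card (meetFamily H s I t) ≤ card (layer H s))
    × (card (containing (layer H r) I) + card (meetFamily H s I t) ≡ card (layer H s) →
       (t ≡ 1) × IsMu H (r + s))
-- t ≤ r is implied by t ≤ ∣ I ∣ ≤ r.
lemma1p10 n (suc t′) r s _ _ r≤s H hered μ-bound I I∈H t≤∣I∣ ∣I∣≤r
  with m , μ≡m ← μ-exists H I∈H =
  let open Setting hered I∈H t≤∣I∣ ∣I∣≤r r≤s μ≡m (μ-bound m μ≡m) in
  card-A+card-B≤card-layer ,
  λ equality → cong suc (equality⇒t′≡0 equality) ,
               subst (λ k → IsMu H (r + s ∸ k)) (equality⇒t′≡0 equality)
                     (subst (IsMu H) (equality⇒m≡r+s∸t′ equality) μ≡m)
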